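{- Let $k\ge 2$ be an integer and let $T$ be a tree of order $n\ge 8$ and diameter $n-t$, where $2\le t\le n-3$. (i) If $2\le t\le \frac{n-1}{3}$, then $n-2t\le \alpha_{k-reg}(T)\le n-4$. (ii) If $\frac{n}{3}\le t\le n-5$, then $\frac{n+2}{3}\le \alpha_{k-reg}(T)\le \max\{n-f(n,t)-1,\ t+1\}$. (iii) If $t=n-4$, then $\lceil \frac{n-1}{2}\rceil\le \alpha_{k-reg}(T)\le t+1$. (iv) If $t=n-3$, then $\alpha_{k-reg}(T)=t+1$.
   Context: All graphs are finite, simple and undirected. For a graph $G$ and an integer $i\ge 0$, $D_i(G)$ denotes the set of vertices of degree $i$ in $G$. For an integer $k\ge 0$, a set $S\subseteq V(G)$ is $k$-independent if the induced subgraph $G[S]$ has maximum degree at most $k$. A regular $k$-independent set is a $k$-independent set $S$ with $S\subseteq D_i(G)$ for some $i$. The regular $k$-independence number $\alpha_{k-reg}(G)$ is the maximum cardinality of a regular $k$-independent set of $G$. For integers $n>t\ge 2$ with $t\le n-3$, define $f(n,t)=\lceil \frac{2(t-1)}{n-t}\rceil+2$ if $n-t$ is even, and $f(n,t)=\lceil\frac{2(t-1)}{n-t-1}\rceil+2$ if $n-t$ is odd. -}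

module Defs where

open import Data.Nat using (ℕ; zero; suc; _+_; _*_; _∸_; _≤_; _/_; _%_; _≡ᵇ_)
open import Data.Bool using (Bool; true; false; if_then_else_)
open import Data.Fin using (Fin)
open import Data.Fin.Subset using (Subset; _∈_; _∩_; ∣_∣)
open import Data.Vec using (tabulate)
open import Data.List using (List; []; _∷_; _++_; length; [_])
open import Data.List.Relation.Unary.Linked using (Linked)
open import Data.List.Relation.Unary.Unique.Propositional using (Unique)
open import Data.Product using (Σ; ∃; _×_)
open import Relation.Binary.PropositionalEquality using (_≡_)
open import Relation.Nullary using (¬_)

record Graph (n : ℕ) : Set where
  field
    adj    : Fin n → Fin n → Bool
    sym    : ∀ u v → adj u v ≡ adj v u
    irrefl : ∀ v → adj v v ≡ false
open Graph public

module _ {n : ℕ} (G : Graph n) where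

  Adj : Fin n → Fin n → Set
  Adj u v = adj G u v ≡ true

  N : Fin n → Subset n
  N v = tabulate (adj G v)

  deg : Fin n → ℕ
  deg v = ∣ N v ∣

  data Walk : Fin n → Fin n → ℕ → Set where
    here : ∀ {v} → Walk v v 0
    step : ∀ {u w v m} → Adj u w → Walk w v m → Walk u v (suc m)

  Connected : Set
  Connected = ∀ u v → ∃ λ m → Walk u v m

  IsCycle : List (Fin n) → Set
  IsCycle [] = Data.Empty.⊥ where import Data.Empty
  IsCycle (x ∷ ys) = (2 ≤ length ys) × Unique (x ∷ ys) × Linked Adj (x ∷ ys ++ [ x ])

  Acyclic : Set
  Acyclic = ∀ cs → ¬ IsCycle cs

  IsTree : Set
  IsTree = Connected × Acyclic

  Dist : Fin n → Fin n → ℕ → Set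
  Dist u v m = Walk u v m × (∀ m' → Walk u v m' → m ≤ m')

  Diameter : ℕ → Set
  Diameter d = (∃ λ u → ∃ λ v → Dist u v d) × (∀ u v m → Dist u v m → m ≤ d)

  D : ℕ → Subset n
  D i = tabulate (λ v → deg v ≡ᵇ i)

  KIndependent : ℕ → Subset n → Set
  KIndependent k S = ∀ v → v ∈ S → ∣ N v ∩ S ∣ ≤ k

  RegKIndependent : ℕ → Subset n → Set
  RegKIndependent k S = KIndependent k S × (∃ λ i → ∀ v → v ∈ S → v ∈ D i)

  IsRegKIndepNumber : ℕ → ℕ → Set
  IsRegKIndepNumber k a =
    (Σ (Subset n) λ S → RegKIndependent k S × ∣ S ∣ ≡ a)
    × (∀ S → RegKIndependent k S → ∣ S ∣ ≤ a)

⌈_/_⌉ : ℕ → (b : ℕ) → .{{_ : Data.Nat.NonZero b}} → ℕ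
⌈ a / b ⌉ = (a + b ∸ 1) / b

-- f(n,t), defined by cases on d = n - t (only meaningful for d ≥ 3, i.e. t ≤ n-3)
fAux : ℕ → ℕ → ℕ
fAux (suc (suc (suc m))) t =
  if (suc (suc (suc m)) % 2) ≡ᵇ 0
  then ⌈ 2 * (t ∸ 1) / suc (suc (suc m)) ⌉ + 2
  else ⌈ 2 * (t ∸ 1) / suc (suc m) ⌉ + 2
fAux _ _ = 0

f : ℕ → ℕ → ℕ
f n t = fAux (n ∸ t) t

-- Since k ≥ 2, the degree classes D₁ and D₂ are k-independent, every regular set lies in one class,
-- and in a tree every class Dⱼ with j ≥ 3 is smaller than D₁ (n₁ = 2 + Σ_{deg w ≥ 3} (deg w − 2));
-- hence α_{k-reg}(T) = max(n₁, n₂) with nⱼ = |Dⱼ|.  Root T at an end u of a diametral path u … v,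
-- the spine, which has d + 1 = n − t + 1 vertices.  Only u and v are leaves on the spine, so
-- n₁ ≤ t + 1.  Sending each off-spine vertex to a leaf below it, a fibre is a hanging chain that
-- starts at some spine level p and, by maximality of d, has length at most min(p, d − p) ≤ ⌊d/2⌋;
-- so t − 1 ≤ (n₁ − 2)⌊d/2⌋.  Together with n = n₁ + n₂ + n_{≥3} these give all four parts.

module Submission where

open import Defs
open import Data.Nat using (ℕ; _+_; _*_; _∸_; _≤_; _⊔_)
open import Data.Product using (_×_)
open import Relation.Binary.PropositionalEquality using (_≡_)

open import Data.Bool using (Bool; true; false; not; _∧_; if_then_else_; T)
open import Data.Bool.Properties using (T-≡)
import Data.Bool.Properties as Boolₚ
open import Data.Empty using (⊥; ⊥-elim)
open import Data.Fin using (Fin; zero; suc; toℕ; fromℕ<)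
open import Data.Fin.Properties using (toℕ-injective)
import Data.Fin.Properties as Finₚ
open import Data.Fin.Subset using (_∈_; ∣_∣)
open import Data.Fin.Subset.Properties using (p⊆q⇒∣p∣≤∣q∣; ∣p∩q∣≤∣p∣)
open import Data.List using (List; []; _∷_; _++_; [_]; length)
open import Data.List.Relation.Unary.All using (All; []; _∷_)
import Data.List.Relation.Unary.All as All
import Data.List.Relation.Unary.All.Properties as All
open import Data.List.Relation.Unary.AllPairs using ([]; _∷_)
import Data.List.Relation.Unary.AllPairs.Properties as AllPairsₚ
open import Data.List.Relation.Unary.Linked using (Linked; []; [-]; _∷_)
open import Data.List.Relation.Unary.Unique.Propositional using (Unique)
open import Data.Nat using (zero; suc; pred; z≤n; s≤s; s≤s⁻¹; _<_; _≡ᵇ_; _<ᵇ_; NonZero; >-nonZero)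
open import Data.Nat.DivMod using (_/_; _%_; m*n/n≡m; /-monoˡ-≤; m<n*o⇒m/o<n; m%n<n; m≡m%n+[m/n]*n)
open import Data.Nat.Properties
open import Algebra.Properties.Semiring.Sum +-*-semiring
  using (sum; ∑-distrib-+; ∑-comm; sum-cong-≗; *-distribˡ-sum; *-distribʳ-sum; sum-replicate-zero)
open import Data.Nat.Tactic.RingSolver using (solve-∀)
open import Data.Product using (Σ; ∃; _,_; proj₁; proj₂)
open import Data.Sum using (_⊎_; inj₁; inj₂; map₂)
open import Data.Vec using (tabulate)
open import Data.Vec.Properties using ([]=⇒lookup; lookup∘tabulate)
open import Function using (_∘_)
open import Function.Bundles using (Equivalence)
open import Relation.Binary using (tri<; tri≈; tri>)
open import Relation.Binary.PropositionalEquality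
  using (_≢_; refl; trans; cong; cong₂; subst; subst₂; module ≡-Reasoning)
  renaming (sym to ≡-sym)
open import Relation.Nullary using (Dec; yes; no; does; ¬_)
open import Relation.Nullary.Decidable using (_×-dec_; dec-true)

does-true⇒ : ∀ {A : Set} (a? : Dec A) → does a? ≡ true → A
does-true⇒ (yes a) _ = a

∧-true⁻ : ∀ {a b} → a ∧ b ≡ true → a ≡ true × b ≡ true
∧-true⁻ {true} {true} refl = refl , refl

not-true⁻ : ∀ {a} → not a ≡ true → a ≡ false
not-true⁻ {false} refl = refl

≡ᵇ-true⇒≡ : ∀ {m n} → (m ≡ᵇ n) ≡ true → m ≡ n
≡ᵇ-true⇒≡ {m} {n} e = ≡ᵇ⇒≡ m n (Equivalence.from T-≡ e)

≡ᵇ-false⇒≢ : ∀ {m n} → (m ≡ᵇ n) ≡ false → m ≢ n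
≡ᵇ-false⇒≢ {m} {n} e m≡n = subst T e (≡⇒≡ᵇ m n m≡n)

_==_ : ∀ {n} → Fin n → Fin n → Bool
x == y = does (x Finₚ.≟ y)

==-refl : ∀ {n} (x : Fin n) → (x == x) ≡ true
==-refl x = dec-true (x Finₚ.≟ x) refl

==⇒≡ : ∀ {n} {x y : Fin n} → (x == y) ≡ true → x ≡ y
==⇒≡ {x = x} {y} = does-true⇒ (x Finₚ.≟ y)

indicator : Bool → ℕ
indicator true  = 1
indicator false = 0

indicator≤1 : ∀ b → indicator b ≤ 1
indicator≤1 true  = s≤s z≤n
indicator≤1 false = z≤n

indicator-∧≤ : ∀ a b → indicator (a ∧ b) ≤ indicator a
indicator-∧≤ true  b = indicator≤1 b
indicator-∧≤ false b = z≤n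

sum-mono-≤ : ∀ {n} {f g : Fin n → ℕ} → (∀ i → f i ≤ g i) → sum f ≤ sum g
sum-mono-≤ {zero}  f≤g = z≤n
sum-mono-≤ {suc n} f≤g = +-mono-≤ (f≤g zero) (sum-mono-≤ (f≤g ∘ suc))

≤-sum : ∀ {n} (f : Fin n → ℕ) i → f i ≤ sum f
≤-sum f zero    = m≤m+n (f zero) _
≤-sum f (suc i) = ≤-trans (≤-sum (f ∘ suc) i) (m≤n+m _ (f zero))

sum-ones : ∀ n → sum {n} (λ _ → 1) ≡ n
sum-ones zero    = refl
sum-ones (suc n) = cong suc (sum-ones n)

0<sum⇒∃ : ∀ {n} (f : Fin n → ℕ) → 0 < sum f → ∃ λ i → 0 < f i
0<sum⇒∃ {suc n} f 0<Σ with f zero in f0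
... | suc _ = zero , subst (0 <_) (≡-sym f0) (s≤s z≤n)
... | zero  = let (i , 0<fi) = 0<sum⇒∃ (f ∘ suc) 0<Σ in suc i , 0<fi

count : ∀ {n} → (Fin n → Bool) → ℕ
count P = sum (indicator ∘ P)

count-true : ∀ n → count {n} (λ _ → true) ≡ n
count-true = sum-ones

count-false : ∀ {n} (P : Fin n → Bool) → (∀ i → P i ≡ false) → count P ≡ 0
count-false {n} P none = trans (sum-cong-≗ (cong indicator ∘ none)) (sum-replicate-zero n)

count+count-not : ∀ {n} (P : Fin n → Bool) → count P + count (not ∘ P) ≡ n
count+count-not {n} P = begin
  count P + count (not ∘ P)                            ≡⟨ ∑-distrib-+ {n} _ _ ⟨
  sum (λ i → indicator (P i) + indicator (not (P i)))  ≡⟨ sum-cong-≗ (partition ∘ P) ⟩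
  sum {n} (λ _ → 1)                                    ≡⟨ sum-ones n ⟩
  n                                                    ∎
  where
  open ≡-Reasoning
  partition : ∀ b → indicator b + indicator (not b) ≡ 1
  partition true  = refl
  partition false = refl

count-split : ∀ {n} (P Q : Fin n → Bool) →
  count P ≡ count (λ x → P x ∧ Q x) + count (λ x → P x ∧ not (Q x))
count-split {n} P Q = trans (sum-cong-≗ (λ x → split (P x) (Q x))) (∑-distrib-+ {n} _ _)
  where
  split : ∀ a b → indicator a ≡ indicator (a ∧ b) + indicator (a ∧ not b)
  split true  true  = refl
  split true  false = refl
  split false _     = refl

count≤1 : ∀ {n} (P : Fin n → Bool) →
  (∀ i j → P i ≡ true → P j ≡ true → i ≡ j) → count P ≤ 1
count≤1 {zero}  P unique = z≤n
count≤1 {suc n} P unique with P zero in P0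
... | true  = ≤-reflexive (cong suc (count-false (P ∘ suc) nothing-else))
  where
  nothing-else : ∀ j → P (suc j) ≡ false
  nothing-else j with P (suc j) in Pj
  ... | true with () ← unique zero (suc j) P0 Pj
  ... | false = refl
... | false = count≤1 (P ∘ suc) (λ i j Pi Pj → Finₚ.suc-injective (unique (suc i) (suc j) Pi Pj))

count-unique : ∀ {n} (P : Fin n → Bool) c → P c ≡ true →
  (∀ i → P i ≡ true → i ≡ c) → count P ≡ 1
count-unique P c Pc unique = ≤-antisym
  (count≤1 P (λ i j Pi Pj → trans (unique i Pi) (≡-sym (unique j Pj))))
  (subst (λ b → indicator b ≤ count P) Pc (≤-sum (indicator ∘ P) c))

count-== : ∀ {n} (c : Fin n) → count (_== c) ≡ 1
count-== c = count-unique (_== c) c (==-refl c) (λ i → ==⇒≡)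

count≤count*fibre : ∀ {m n} (P : Fin m → Bool) (Q : Fin n → Bool) (g : Fin m → Fin n) B →
  (∀ x → P x ≡ true → Q (g x) ≡ true) →
  (∀ y → count (λ x → P x ∧ (g x == y)) ≤ B) → count P ≤ count Q * B
count≤count*fibre {m} {n} P Q g B P⇒Qg fibre≤B = begin
  count P
    ≡⟨ sum-cong-≗ {m} by-image ⟩
  sum (λ x → sum (λ y → indicator (P x ∧ (g x == y))))
    ≤⟨ sum-mono-≤ (λ x → sum-mono-≤ (Q-weight x)) ⟩
  sum (λ x → sum (λ y → indicator (Q y) * indicator (P x ∧ (g x == y))))
    ≡⟨ ∑-comm {m} {n} _ ⟩
  sum (λ y → sum (λ x → indicator (Q y) * indicator (P x ∧ (g x == y))))
    ≡⟨ sum-cong-≗ (λ y → *-distribˡ-sum {m} (indicator (Q y)) _) ⟨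
  sum (λ y → indicator (Q y) * count (λ x → P x ∧ (g x == y)))
    ≤⟨ sum-mono-≤ (λ y → *-monoʳ-≤ (indicator (Q y)) (fibre≤B y)) ⟩
  sum (λ y → indicator (Q y) * B)
    ≡⟨ *-distribʳ-sum B (indicator ∘ Q) ⟨
  count Q * B ∎
  where
  open ≤-Reasoning
  by-image : ∀ x → indicator (P x) ≡ sum (λ y → indicator (P x ∧ (g x == y)))
  by-image x with P x
  ... | true  = ≡-sym (count-unique (g x ==_) (g x) (==-refl (g x)) (λ y → ≡-sym ∘ ==⇒≡))
  ... | false = ≡-sym (sum-replicate-zero n)
  Q-weight : ∀ x y → indicator (P x ∧ (g x == y)) ≤ indicator (Q y) * indicator (P x ∧ (g x == y))
  Q-weight x y with P x ∧ (g x == y) in e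
  ... | false = z≤n
  ... | true  with ∧-true⁻ {P x} e
  ... | Px , gx==y with refl ← ==⇒≡ {x = g x} gx==y rewrite P⇒Qg x Px = ≤-refl

count-≤-injection : ∀ {m n} (P : Fin m → Bool) (Q : Fin n → Bool) (g : Fin m → Fin n) →
  (∀ x → P x ≡ true → Q (g x) ≡ true) →
  (∀ x y → P x ≡ true → P y ≡ true → g x ≡ g y → x ≡ y) → count P ≤ count Q
count-≤-injection P Q g P⇒Qg injective =
  ≤-trans (count≤count*fibre P Q g 1 P⇒Qg fibre≤1) (≤-reflexive (*-identityʳ _))
  where
  fibre≤1 : ∀ y → count (λ x → P x ∧ (g x == y)) ≤ 1
  fibre≤1 y = count≤1 _ λ i j i∈ j∈ →
    let (Pi , gi≡y) = ∧-true⁻ i∈ ; (Pj , gj≡y) = ∧-true⁻ j∈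
    in injective i j Pi Pj (trans (==⇒≡ gi≡y) (≡-sym (==⇒≡ gj≡y)))

count-injective-below : ∀ {n} (P : Fin n → Bool) (g : Fin n → ℕ) B →
  (∀ x → P x ≡ true → g x < B) →
  (∀ x y → P x ≡ true → P y ≡ true → g x ≡ g y → x ≡ y) → count P ≤ B
count-injective-below P g zero below _ = ≤-reflexive (count-false P empty)
  where
  empty : ∀ x → P x ≡ false
  empty x with P x in Px
  ... | true with () ← below x Px
  ... | false = refl
count-injective-below P g (suc B) below injective = begin
  count P                          ≡⟨ count-split P (λ x → g x ≡ᵇ B) ⟩
  count at-B + count below-B       ≤⟨ +-mono-≤ (count≤1 at-B at-B-unique) below-B-bound ⟩
  suc B                            ∎
  where
  open ≤-Reasoning
  at-B below-B : _ → Bool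
  at-B    x = P x ∧ (g x ≡ᵇ B)
  below-B x = P x ∧ not (g x ≡ᵇ B)
  at-B⁻ : ∀ x → at-B x ≡ true → P x ≡ true × g x ≡ B
  at-B⁻ x e = let (Px , gx≡B) = ∧-true⁻ {P x} e in Px , ≡ᵇ-true⇒≡ gx≡B
  below-B⁻ : ∀ x → below-B x ≡ true → P x ≡ true × g x < B
  below-B⁻ x e = let (Px , gx≢B) = ∧-true⁻ {P x} e
                 in Px , ≤∧≢⇒< (s≤s⁻¹ (below x Px)) (≡ᵇ-false⇒≢ (not-true⁻ gx≢B))
  at-B-unique : ∀ x y → at-B x ≡ true → at-B y ≡ true → x ≡ y
  at-B-unique x y ex ey =
    let (Px , gx≡B) = at-B⁻ x ex ; (Py , gy≡B) = at-B⁻ y ey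
    in injective x y Px Py (trans gx≡B (≡-sym gy≡B))
  below-B-bound : count below-B ≤ B
  below-B-bound = count-injective-below below-B g B (λ x → proj₂ ∘ below-B⁻ x)
    (λ x y ex ey → injective x y (proj₁ (below-B⁻ x ex)) (proj₁ (below-B⁻ y ey)))

∣tabulate∣≡count : ∀ {n} (P : Fin n → Bool) → ∣ tabulate P ∣ ≡ count P
∣tabulate∣≡count {zero}  P = refl
∣tabulate∣≡count {suc n} P with P zero
... | true  = cong suc (∣tabulate∣≡count (P ∘ suc))
... | false = ∣tabulate∣≡count (P ∘ suc)

suc[m∸1+n]≡m∸n : ∀ m n → n < m → suc (m ∸ suc n) ≡ m ∸ n
suc[m∸1+n]≡m∸n (suc m) n (s≤s n≤m) = ≡-sym (+-∸-assoc 1 n≤m)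

m≤n∸1⇒m+1≤n : ∀ {m} n → 1 ≤ m → m ≤ n ∸ 1 → m + 1 ≤ n
m≤n∸1⇒m+1≤n n 1≤m m≤n∸1 =
  ≤-trans (+-monoˡ-≤ 1 m≤n∸1) (≤-reflexive (m∸n+n≡m (≤-trans 1≤m (≤-trans m≤n∸1 (m∸n≤m n 1)))))

m+m≤n⇒m≤n/2 : ∀ m n → m + m ≤ n → m ≤ n / 2
m+m≤n⇒m≤n/2 m n m+m≤n = subst (_≤ n / 2) (m*n/n≡m m 2) (/-monoˡ-≤ 2 (subst (_≤ n) (+-*-double m) m+m≤n))
  where
  +-*-double : ∀ m → m + m ≡ m * 2
  +-*-double = solve-∀

l∸1+p<d/2 : ∀ {p l L d} → p < l → l ≤ L → L ≤ 2 * p → L ≤ d → l ∸ suc p < d / 2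
l∸1+p<d/2 {p} {l} {L} {d} p<l l≤L L≤2p L≤d = begin-strict
  l ∸ suc p        <⟨ ≤-reflexive (suc[m∸1+n]≡m∸n l p p<l) ⟩
  l ∸ p            ≤⟨ ∸-monoˡ-≤ p l≤L ⟩
  L ∸ p            ≤⟨ m+m≤n⇒m≤n/2 (L ∸ p) d (begin
    (L ∸ p) + (L ∸ p) ≤⟨ +-monoʳ-≤ (L ∸ p) (m≤n+o⇒m∸n≤o L p (≤-trans L≤2p (≤-reflexive (2*p≡p+p p)))) ⟩
    (L ∸ p) + p       ≡⟨ m∸n+n≡m (≤-trans (n≤1+n p) (≤-trans p<l l≤L)) ⟩
    L                 ≤⟨ L≤d ⟩
    d                 ∎) ⟩
  d / 2            ∎
  where
  open ≤-Reasoning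
  2*p≡p+p : ∀ p → 2 * p ≡ p + p
  2*p≡p+p = solve-∀

⌈/⌉≤ : ∀ a b c .{{_ : NonZero b}} → a ≤ c * b → ⌈ a / b ⌉ ≤ c
⌈/⌉≤ a (suc b) c a≤cb = s≤s⁻¹ (m<n*o⇒m/o<n (begin-strict
  a + suc b ∸ 1     ≡⟨ +-∸-assoc a {suc b} {1} (s≤s z≤n) ⟩
  a + b             ≤⟨ +-monoˡ-≤ b a≤cb ⟩
  c * suc b + b     <⟨ n<1+n _ ⟩
  suc (c * suc b + b) ≡⟨ expand c b ⟩
  suc c * suc b     ∎))
  where
  open ≤-Reasoning
  expand : ∀ c b → suc (c * suc b + b) ≡ suc c * suc b
  expand = solve-∀

⌈2m/2h⌉≤ : ∀ {m} c h D .{{_ : NonZero D}} → D ≡ h * 2 → m ≤ c * h → ⌈ 2 * m / D ⌉ ≤ c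
⌈2m/2h⌉≤ {m} c h D refl m≤ch = ⌈/⌉≤ (2 * m) D c (≤-trans (*-monoʳ-≤ 2 m≤ch) (≤-reflexive (swap c h)))
  where
  swap : ∀ c h → 2 * (c * h) ≡ c * (h * 2)
  swap = solve-∀

-- For d ≥ 3 the denominator of f (d if d is even, d - 1 if d is odd) is 2 ⌊d/2⌋ in both cases.
fAux≤ : ∀ d t c → 3 ≤ d → t ∸ 1 ≤ c * (d / 2) → fAux d t ≤ c + 2
fAux≤ d@(suc (suc (suc m))) t c _ t∸1≤ch with d % 2 in parity | m%n<n d 2
... | zero        | _ = +-monoˡ-≤ 2 (⌈2m/2h⌉≤ c (d / 2) d d≡2h t∸1≤ch)
  where d≡2h = trans (m≡m%n+[m/n]*n d 2) (cong (_+ d / 2 * 2) parity)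
... | suc zero    | _ = +-monoˡ-≤ 2 (⌈2m/2h⌉≤ c (d / 2) (suc (suc m)) d∸1≡2h t∸1≤ch)
  where d∸1≡2h = cong pred (trans (m≡m%n+[m/n]*n d 2) (cong (_+ d / 2 * 2) parity))
... | suc (suc _) | s≤s (s≤s ())
fAux≤ (suc zero)       _ _ (s≤s ()) _
fAux≤ (suc (suc zero)) _ _ (s≤s (s≤s ())) _

least-witness : (P : ℕ → Set) → (∀ m → Dec (P m)) → ∀ k → P k →
  Σ ℕ λ m → P m × (∀ m' → P m' → m ≤ m')
least-witness P P? k Pk = search k 0 (λ _ _ → z≤n) (subst P (≡-sym (+-identityʳ k)) Pk)
  where
  search : ∀ fuel j → (∀ i → P i → j ≤ i) → P (fuel + j) → Σ ℕ λ m → P m × (∀ m' → P m' → m ≤ m')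
  search zero       j j≤ Pj = j , Pj , j≤
  search (suc fuel) j j≤ P[fuel+j] with P? j
  ... | yes Pj = j , Pj , j≤
  ... | no ¬Pj = search fuel (suc j) (λ i Pi → ≤∧≢⇒< (j≤ i Pi) (λ j≡i → ¬Pj (subst P (≡-sym j≡i) Pi)))
                   (subst P (≡-sym (+-suc fuel j)) P[fuel+j])

linked-∷ʳ : ∀ {A : Set} {R : A → A → Set} a xs b c →
  Linked R (a ∷ xs ++ [ b ]) → R b c → Linked R (a ∷ (xs ++ [ b ]) ++ [ c ])
linked-∷ʳ a []       b c (Rab ∷ [-]) Rbc = Rab ∷ Rbc ∷ [-]
linked-∷ʳ a (x ∷ xs) b c (Rax ∷ Rxs) Rbc = Rax ∷ linked-∷ʳ x xs b c Rxs Rbc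

1≤length-∷ʳ : ∀ {A : Set} (xs : List A) c → 1 ≤ length (xs ++ [ c ])
1≤length-∷ʳ []      c = s≤s z≤n
1≤length-∷ʳ (_ ∷ _) c = s≤s z≤n

unique-∷ʳ : ∀ {A : Set} (xs : List A) c → Unique xs → All (_≢ c) xs → Unique (xs ++ [ c ])
unique-∷ʳ xs c u xs≢c = AllPairsₚ.++⁺ u ([] ∷ []) (All.map (_∷ []) xs≢c)

module Tree {n : ℕ} (G : Graph n) (connected : Connected G) (acyclic : Acyclic G) where

  infix 4 _∼_
  _∼_ : Fin n → Fin n → Set
  _∼_ = Adj G

  _∼?_ : ∀ x y → Dec (x ∼ y)
  x ∼? y = adj G x y Boolₚ.≟ true

  ∼-sym : ∀ {x y} → x ∼ y → y ∼ x
  ∼-sym {x} {y} x∼y = trans (Graph.sym G y x) x∼y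

  ∼-irrefl : ∀ {x} → ¬ x ∼ x
  ∼-irrefl {x} x∼x with () ← trans (≡-sym x∼x) (Graph.irrefl G x)

  walk? : ∀ m x y → Dec (Walk G x y m)
  walk? zero x y with x Finₚ.≟ y
  ... | yes refl = yes here
  ... | no x≢y   = no λ { here → x≢y refl }
  walk? (suc m) x y with Finₚ.any? (λ w → (x ∼? w) ×-dec walk? m w y)
  ... | yes (w , x∼w , p) = yes (step x∼w p)
  ... | no ¬w             = no λ { (step {w = w} x∼w p) → ¬w (w , x∼w , p) }

  abstract
    dist : Fin n → Fin n → ℕ
    dist x y = proj₁ (least-witness (Walk G x y) (λ m → walk? m x y) _ (proj₂ (connected x y)))

    dist-correct : ∀ x y → Dist G x y (dist x y)
    dist-correct x y = proj₂ (least-witness (Walk G x y) (λ m → walk? m x y) _ (proj₂ (connected x y)))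

  snoc : ∀ {x y z m} → Walk G x y m → y ∼ z → Walk G x z (suc m)
  snoc here       y∼z = step y∼z here
  snoc (step x∼w p) y∼z = step x∼w (snoc p y∼z)

  reverse : ∀ {x y m} → Walk G x y m → Walk G y x m
  reverse here         = here
  reverse (step x∼w p) = snoc (reverse p) (∼-sym x∼w)

  degree : Fin n → ℕ
  degree w = count (adj G w)

  ∼⇒1≤degree : ∀ {z x} → z ∼ x → 1 ≤ degree z
  ∼⇒1≤degree {z} {x} z∼x = subst (λ b → indicator b ≤ degree z) z∼x (≤-sum (indicator ∘ adj G z) x)

  two-neighbours⇒2≤degree : ∀ {z a b} → z ∼ a → z ∼ b → a ≢ b → 2 ≤ degree z
  two-neighbours⇒2≤degree {z} {a} {b} z∼a z∼b a≢b =
    count-≤-injection (λ _ → true) (adj G z) neighbour (λ { zero _ → z∼a ; (suc zero) _ → z∼b })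
      (λ { zero zero _ _ _ → refl ; zero (suc zero) _ _ a≡b → ⊥-elim (a≢b a≡b)
         ; (suc zero) zero _ _ b≡a → ⊥-elim (a≢b (≡-sym b≡a)) ; (suc zero) (suc zero) _ _ _ → refl })
    where
    neighbour : Fin 2 → Fin n
    neighbour zero       = a
    neighbour (suc zero) = b

  neighbours≡⇒degree≤1 : ∀ z c → (∀ x → z ∼ x → x ≡ c) → degree z ≤ 1
  neighbours≡⇒degree≤1 z c only-c = count≤1 (adj G z) (λ i j z∼i z∼j → trans (only-c i z∼i) (≡-sym (only-c j z∼j)))

  module RootedAt (root : Fin n) where

    level : Fin n → ℕ
    level w = dist w root

    level-walk : ∀ w → Walk G w root (level w)
    level-walk w = proj₁ (dist-correct w root)

    level-minimal : ∀ w m → Walk G w root m → level w ≤ m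
    level-minimal w = proj₂ (dist-correct w root)

    level-root : level root ≡ 0
    level-root = n≤0⇒n≡0 (level-minimal root 0 here)

    level≡0⇒root : ∀ {w} → level w ≡ 0 → w ≡ root
    level≡0⇒root {w} e with here ← subst (Walk G w root) e (level-walk w) = refl

    level-∼ : ∀ {x y} → x ∼ y → level x ≤ suc (level y)
    level-∼ x∼y = level-minimal _ _ (step x∼y (level-walk _))

    level>0 : ∀ {w} → w ≢ root → 0 < level w
    level>0 {w} w≢root with level w in e
    ... | zero  = ⊥-elim (w≢root (level≡0⇒root e))
    ... | suc _ = s≤s z≤n

    IsParentOf : Fin n → Fin n → Set
    IsParentOf x w = w ∼ x × suc (level x) ≡ level w

    isParentOf? : ∀ x w → Dec (IsParentOf x w)
    isParentOf? x w = (w ∼? x) ×-dec (suc (level x) ≟ level w)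

    parent? : ∀ w → Dec (∃ λ x → IsParentOf x w)
    parent? w = Finₚ.any? (λ x → isParentOf? x w)

    parent : Fin n → Fin n
    parent w with parent? w
    ... | yes (x , _) = x
    ... | no _        = w

    parent-exists : ∀ w k → level w ≡ suc k → ∃ λ x → IsParentOf x w
    parent-exists w k e with subst (Walk G w root) e (level-walk w)
    ... | step {w = x} w∼x p =
      x , w∼x , ≤-antisym (≤-trans (s≤s (level-minimal x k p)) (≤-reflexive (≡-sym e))) (level-∼ w∼x)

    parent-spec : ∀ w → 0 < level w → IsParentOf (parent w) w
    parent-spec w 0<l with parent? w
    ... | yes (_ , x-parent) = x-parent
    ... | no ¬parent = ⊥-elim (¬parent (parent-exists w _ (≡-sym (suc-pred (level w) {{>-nonZero 0<l}}))))

    parent-root : parent root ≡ root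
    parent-root with parent? root
    ... | yes (_ , _ , e) = ⊥-elim (1+n≢0 (trans e level-root))
    ... | no _ = refl

    ∼-parent : ∀ w → 0 < level w → w ∼ parent w
    ∼-parent w 0<l = proj₁ (parent-spec w 0<l)

    level-parent : ∀ w → 0 < level w → suc (level (parent w)) ≡ level w
    level-parent w 0<l = proj₂ (parent-spec w 0<l)

    ≢-above : ∀ {m p z} → level p ≡ m → m < level z → p ≢ z
    ≢-above lp m<z refl = <-irrefl (≡-sym lp) m<z

    -- Moving both ends to their parents either closes a cycle or gives the same configuration one level lower.
    no-path-above : ∀ m a b (M : List (Fin n)) → level a ≡ m → level b ≡ m → a ≢ b →
      Unique (a ∷ M ++ [ b ]) → Linked _∼_ (a ∷ M ++ [ b ]) → All (λ z → m ≤ level z) (a ∷ M ++ [ b ]) → ⊥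
    no-path-above zero a b M la lb a≢b _ _ _ = a≢b (trans (level≡0⇒root la) (≡-sym (level≡0⇒root lb)))
    no-path-above (suc m) a b M la lb a≢b U L above
      with parent-spec a (subst (0 <_) (≡-sym la) (s≤s z≤n))
         | parent-spec b (subst (0 <_) (≡-sym lb) (s≤s z≤n))
         | parent a Finₚ.≟ parent b
    ... | a∼pa , lpa | b∼pb , lpb | yes pa≡pb =
      acyclic (parent a ∷ a ∷ M ++ [ b ])
        ( s≤s (1≤length-∷ʳ M b)
        , All.map (≢-above level-pa) above ∷ U
        , ∼-sym a∼pa ∷ linked-∷ʳ a M b (parent a) L (subst (b ∼_) (≡-sym pa≡pb) b∼pb))
      where
      level-pa = suc-injective (trans lpa la)
    ... | a∼pa , lpa | b∼pb , lpb | no pa≢pb =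
      no-path-above m (parent a) (parent b) (a ∷ M ++ [ b ]) level-pa level-pb pa≢pb
        ( All.++⁺ (All.map (≢-above level-pa) above) (pa≢pb ∷ [])
        ∷ unique-∷ʳ (a ∷ M ++ [ b ]) (parent b) U (All.map (λ m<z z≡pb → ≢-above level-pb m<z (≡-sym z≡pb)) above))
        (∼-sym a∼pa ∷ linked-∷ʳ a M b (parent b) L b∼pb)
        (≤-reflexive (≡-sym level-pa) ∷ All.++⁺ (All.map (≤-trans (n≤1+n m)) above) (≤-reflexive (≡-sym level-pb) ∷ []))
      where
      level-pa = suc-injective (trans lpa la)
      level-pb = suc-injective (trans lpb lb)

    ∼⇒level≢ : ∀ {x y} → x ∼ y → level x ≢ level y
    ∼⇒level≢ {x} {y} x∼y lx≡ly =
      no-path-above (level x) x y [] refl (≡-sym lx≡ly) x≢y ((x≢y ∷ []) ∷ [] ∷ []) (x∼y ∷ [-])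
        (≤-refl ∷ ≤-reflexive lx≡ly ∷ [])
      where
      x≢y : x ≢ y
      x≢y refl = ∼-irrefl x∼y

    parent-unique : ∀ {w x y} → IsParentOf x w → IsParentOf y w → x ≡ y
    parent-unique {w} {x} {y} (w∼x , lx) (w∼y , ly) with x Finₚ.≟ y
    ... | yes x≡y = x≡y
    ... | no x≢y  = ⊥-elim (no-path-above (level x) x y [ w ] refl ly≡lx x≢y
            ((x≢w ∷ x≢y ∷ []) ∷ (w≢y ∷ []) ∷ [] ∷ []) (∼-sym w∼x ∷ w∼y ∷ [-])
            (≤-refl ∷ ≤-trans (n≤1+n _) (≤-reflexive lx) ∷ ≤-reflexive (≡-sym ly≡lx) ∷ []))
      where
      ly≡lx : level y ≡ level x
      ly≡lx = suc-injective (trans ly (≡-sym lx))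
      x≢w : x ≢ w
      x≢w refl = 1+n≢n lx
      w≢y : w ≢ y
      w≢y refl = 1+n≢n ly

    ∼⇒parent : ∀ {x y} → x ∼ y → IsParentOf y x ⊎ IsParentOf x y
    ∼⇒parent {x} {y} x∼y with <-cmp (level x) (level y)
    ... | tri≈ _ lx≡ly _ = ⊥-elim (∼⇒level≢ x∼y lx≡ly)
    ... | tri< lx<ly _ _ = inj₂ (∼-sym x∼y , ≤-antisym lx<ly (level-∼ (∼-sym x∼y)))
    ... | tri> _ _ ly<lx = inj₁ (x∼y , ≤-antisym ly<lx (level-∼ x∼y))

    IsParentOf⇒≡parent : ∀ {x w} → IsParentOf x w → x ≡ parent w
    IsParentOf⇒≡parent {x} {w} x-parent@(_ , lx) =
      parent-unique x-parent (parent-spec w (subst (0 <_) lx (s≤s z≤n)))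

    -- Opaque, so that with-abstraction over parentᵇ x w is not defeated by unfolding it.
    opaque
      parentᵇ : Fin n → Fin n → Bool
      parentᵇ x w = does (isParentOf? x w)

      parentᵇ⇒ : ∀ {x w} → parentᵇ x w ≡ true → IsParentOf x w
      parentᵇ⇒ {x} {w} = does-true⇒ (isParentOf? x w)

      ⇒parentᵇ : ∀ {x w} → IsParentOf x w → parentᵇ x w ≡ true
      ⇒parentᵇ {x} {w} = dec-true (isParentOf? x w)

    edge-oriented : ∀ w x → indicator (adj G w x) ≡ indicator (parentᵇ x w) + indicator (parentᵇ w x)
    edge-oriented w x with parentᵇ x w in px | parentᵇ w x in pw | adj G w x in w∼x
    ... | true | true | true =
      ⊥-elim (1+n≰n (≤-trans (≤-reflexive lw) (≤-trans (n≤1+n _) (≤-reflexive lx))))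
      where
      lx = proj₂ (parentᵇ⇒ px)
      lw = proj₂ (parentᵇ⇒ pw)
    ... | true  | false | true = refl
    ... | false | true  | true = refl
    ... | false | false | true with ∼⇒parent w∼x
    ...   | inj₁ x-parent with () ← trans (≡-sym px) (⇒parentᵇ x-parent)
    ...   | inj₂ w-parent with () ← trans (≡-sym pw) (⇒parentᵇ w-parent)
    edge-oriented w x | true | _ | false
      with () ← trans (≡-sym w∼x) (proj₁ (parentᵇ⇒ px))
    edge-oriented w x | false | true | false
      with () ← trans (≡-sym w∼x) (∼-sym (proj₁ (parentᵇ⇒ pw)))
    edge-oriented w x | false | false | false = refl

    count-parents : ∀ w → count (λ x → parentᵇ x w) ≡ indicator (not (w == root))
    count-parents w with w Finₚ.≟ root
    ... | yes refl = count-false _ no-parent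
      where
      no-parent : ∀ x → parentᵇ x root ≡ false
      no-parent x with parentᵇ x root in px
      ... | true  = ⊥-elim (1+n≢0 (trans (proj₂ (parentᵇ⇒ px)) level-root))
      ... | false = refl
    ... | no w≢root = count-unique _ (parent w) (⇒parentᵇ (parent-spec w (level>0 w≢root)))
                        (λ x → IsParentOf⇒≡parent ∘ parentᵇ⇒)

    handshake : sum degree + 2 ≡ n + n
    handshake = begin
      sum degree + 2
        ≡⟨ cong (_+ 2) (sum-cong-≗ (λ w → trans (sum-cong-≗ (edge-oriented w)) (∑-distrib-+ {n} _ _))) ⟩
      sum (λ w → up w + down w) + 2
        ≡⟨ cong (_+ 2) (∑-distrib-+ {n} up down) ⟩
      sum up + sum down + 2
        ≡⟨ cong (λ s → sum up + s + 2) (∑-comm {n} {n} (λ w x → indicator (parentᵇ w x))) ⟩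
      sum up + sum up + 2
        ≡⟨ cong (λ s → s + s + 2) (sum-cong-≗ count-parents) ⟩
      r + r + 2
        ≡⟨ regroup r ⟩
      (r + 1) + (r + 1)
        ≡⟨ cong (λ s → s + s) non-roots ⟩
      n + n ∎
      where
      open ≡-Reasoning
      up down : Fin n → ℕ
      up   w = count (λ x → parentᵇ x w)
      down w = count (λ x → parentᵇ w x)
      r = count (λ w → not (w == root))
      non-roots : r + 1 ≡ n
      non-roots = trans (+-comm r 1) (trans (cong (_+ r) (≡-sym (count-== root))) (count+count-not (_== root)))
      regroup : ∀ r → r + r + 2 ≡ (r + 1) + (r + 1)
      regroup = solve-∀

    level-parent≤ : ∀ w → level (parent w) ≤ level w
    level-parent≤ w with w Finₚ.≟ root
    ... | yes refl = ≤-reflexive (cong level parent-root)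
    ... | no w≢root = ≤-trans (n≤1+n _) (≤-reflexive (level-parent w (level>0 w≢root)))

    ancestor : ℕ → Fin n → Fin n
    ancestor zero    z = z
    ancestor (suc j) z = parent (ancestor j z)

    level-ancestor : ∀ j z → j ≤ level z → level (ancestor j z) + j ≡ level z
    level-ancestor zero    z _   = +-identityʳ _
    level-ancestor (suc j) z j<l = begin
      level (parent (ancestor j z)) + suc j   ≡⟨ +-suc _ j ⟩
      suc (level (parent (ancestor j z))) + j ≡⟨ cong (_+ j) (level-parent (ancestor j z) 0<l) ⟩
      level (ancestor j z) + j                ≡⟨ ih ⟩
      level z                                 ∎
      where
      open ≡-Reasoning
      ih = level-ancestor j z (≤-trans (n≤1+n j) j<l)
      0<l : 0 < level (ancestor j z)
      0<l = +-cancelʳ-< j 0 (level (ancestor j z)) (subst (j <_) (≡-sym ih) j<l)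

    ancestor-root : ∀ z → ancestor (level z) z ≡ root
    ancestor-root z = level≡0⇒root (+-cancelʳ-≡ (level z) _ 0 (level-ancestor (level z) z ≤-refl))

    Childless : Fin n → Set
    Childless w = ∀ x → ¬ IsParentOf w x

    child? : ∀ w → Dec (∃ λ x → IsParentOf w x)
    child? w = Finₚ.any? (isParentOf? w)

    descend : ℕ → Fin n → Fin n
    descend zero    w = w
    descend (suc k) w with child? w
    ... | yes (x , _) = descend k x
    ... | no _        = w

    descend-spec : ∀ k w → Σ ℕ λ j → ancestor j (descend k w) ≡ w × level (descend k w) ≡ j + level w
                                     × (Childless (descend k w) ⊎ j ≡ k)
    descend-spec zero    w = 0 , refl , refl , inj₂ refl
    descend-spec (suc k) w with child? w
    ... | no childless = 0 , refl , refl , inj₁ (λ x w-parent → childless (x , w-parent))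
    ... | yes (x , w-parent@(_ , lx)) with descend-spec k x
    ...   | j , anc , lev , stop =
      suc j , trans (cong parent anc) (≡-sym (IsParentOf⇒≡parent w-parent))
            , trans lev (trans (cong (j +_) (≡-sym lx)) (+-suc j (level w)))
            , map₂ (cong suc) stop

    childless⇒degree≡1 : ∀ z → z ≢ root → Childless z → degree z ≡ 1
    childless⇒degree≡1 z z≢root childless = ≤-antisym
      (neighbours≡⇒degree≤1 z (parent z) only-parent) (∼⇒1≤degree (∼-parent z (level>0 z≢root)))
      where
      only-parent : ∀ x → z ∼ x → x ≡ parent z
      only-parent x z∼x with ∼⇒parent z∼x
      ... | inj₁ x-parent = IsParentOf⇒≡parent x-parent
      ... | inj₂ z-parent = ⊥-elim (childless x z-parent)

    module Spine (v : Fin n) (d : ℕ) (root-v : Dist G root v d)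
                 (diameter : ∀ x y m → Dist G x y m → m ≤ d) (0<d : 0 < d) where

      level-v : level v ≡ d
      level-v = ≤-antisym (level-minimal v d (reverse (proj₁ root-v)))
                          (proj₂ root-v (level v) (reverse (level-walk v)))

      level≤d : ∀ w → level w ≤ d
      level≤d w = diameter w root (level w) (dist-correct w root)

      spine : ℕ → Fin n
      spine k = ancestor (d ∸ k) v

      level-spine : ∀ {k} → k ≤ d → level (spine k) ≡ k
      level-spine {k} k≤d = +-cancelʳ-≡ (d ∸ k) _ _ (begin
        level (spine k) + (d ∸ k) ≡⟨ level-ancestor (d ∸ k) v (subst (d ∸ k ≤_) (≡-sym level-v) (m∸n≤m d k)) ⟩
        level v                   ≡⟨ level-v ⟩
        d                         ≡⟨ m+[n∸m]≡n k≤d ⟨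
        k + (d ∸ k)               ∎)
        where open ≡-Reasoning

      spine-injective : ∀ {i j} → i ≤ d → j ≤ d → spine i ≡ spine j → i ≡ j
      spine-injective i≤d j≤d e = trans (≡-sym (level-spine i≤d)) (trans (cong level e) (level-spine j≤d))

      spine-0 : spine 0 ≡ root
      spine-0 = subst (λ m → ancestor m v ≡ root) level-v (ancestor-root v)

      spine-d : spine d ≡ v
      spine-d = cong (λ m → ancestor m v) (n∸n≡0 d)

      parent-spine : ∀ {k} → k < d → parent (spine (suc k)) ≡ spine k
      parent-spine {k} k<d = cong (λ m → ancestor m v) (suc[m∸1+n]≡m∸n d k k<d)

      -- The spine is the path root = spine 0, …, spine d = v, and it meets every level exactly once.
      onSpine : Fin n → Bool
      onSpine z = spine (level z) == z

      onSpine⇒≡ : ∀ {z} → onSpine z ≡ true → spine (level z) ≡ z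
      onSpine⇒≡ = ==⇒≡

      onSpine-spine : ∀ {k} → k ≤ d → onSpine (spine k) ≡ true
      onSpine-spine {k} k≤d = subst (λ m → (spine m == spine k) ≡ true) (≡-sym (level-spine k≤d)) (==-refl (spine k))

      onSpine-root : onSpine root ≡ true
      onSpine-root = subst (λ z → onSpine z ≡ true) spine-0 (onSpine-spine z≤n)

      onSpine-v : onSpine v ≡ true
      onSpine-v = subst (λ z → onSpine z ≡ true) spine-d (onSpine-spine ≤-refl)

      offSpine⇒≢root : ∀ {z} → onSpine z ≡ false → z ≢ root
      offSpine⇒≢root off refl with () ← trans (≡-sym off) onSpine-root

      onSpine-parent : ∀ z → onSpine z ≡ true → onSpine (parent z) ≡ true
      onSpine-parent z on with z Finₚ.≟ root
      ... | yes refl = subst (λ w → onSpine w ≡ true) (≡-sym parent-root) onSpine-root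
      ... | no z≢root = subst (λ w → onSpine w ≡ true) parent≡spine (onSpine-spine (≤-trans (n≤1+n k) k<d))
        where
        k = pred (level z)
        level-z : level z ≡ suc k
        level-z = ≡-sym (suc-pred (level z) {{>-nonZero (level>0 z≢root)}})
        k<d : k < d
        k<d = subst (_≤ d) level-z (level≤d z)
        parent≡spine : spine k ≡ parent z
        parent≡spine = trans (≡-sym (parent-spine k<d)) (cong parent (trans (cong spine (≡-sym level-z)) (onSpine⇒≡ on)))

      onSpine-ancestor : ∀ j {z} → onSpine z ≡ true → onSpine (ancestor j z) ≡ true
      onSpine-ancestor zero    on = on
      onSpine-ancestor (suc j) on = onSpine-parent _ (onSpine-ancestor j on)

      offSpine-descendant : ∀ j z → onSpine (ancestor j z) ≡ false → onSpine z ≡ false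
      offSpine-descendant j z off with onSpine z in on
      ... | false = refl
      ... | true with () ← trans (≡-sym off) (onSpine-ancestor j on)

      -- The level of the first spine vertex on the way from z to the root; the level of z is the fuel.
      attach : ℕ → Fin n → ℕ
      attach zero    z = 0
      attach (suc k) z = if onSpine z then level z else attach k (parent z)

      attachment : Fin n → ℕ
      attachment z = attach (level z) z

      level-parent-offSpine : ∀ {z} → onSpine z ≡ false → level z ≡ suc (level (parent z))
      level-parent-offSpine off = ≡-sym (level-parent _ (level>0 (offSpine⇒≢root off)))

      attachment-onSpine : ∀ z → onSpine z ≡ true → attachment z ≡ level z
      attachment-onSpine z on = go (level z) refl
        where
        go : ∀ k → level z ≡ k → attach k z ≡ level z
        go zero    e = ≡-sym e
        go (suc k) e rewrite on = refl

      attachment-offSpine : ∀ z → onSpine z ≡ false → attachment z ≡ attachment (parent z)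
      attachment-offSpine z off = trans (cong (λ k → attach k z) (level-parent-offSpine off)) step-up
        where
        step-up : attach (suc (level (parent z))) z ≡ attachment (parent z)
        step-up rewrite off = refl

      attachment≤level : ∀ z → attachment z ≤ level z
      attachment≤level z = go (level z) z refl
        where
        go : ∀ k z → level z ≡ k → attach k z ≤ k
        go zero    z _ = z≤n
        go (suc k) z e with onSpine z in on
        ... | true  = ≤-reflexive e
        ... | false = ≤-trans (go k (parent z) (suc-injective (trans (≡-sym (level-parent-offSpine on)) e))) (n≤1+n k)

      attachment<level : ∀ z → onSpine z ≡ false → attachment z < level z
      attachment<level z off = begin-strict
        attachment z          ≡⟨ attachment-offSpine z off ⟩
        attachment (parent z) ≤⟨ attachment≤level (parent z) ⟩
        level (parent z)      <⟨ n<1+n _ ⟩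
        suc (level (parent z)) ≡⟨ level-parent-offSpine off ⟨
        level z               ∎
        where open ≤-Reasoning

      attachment-parent≤ : ∀ z → attachment (parent z) ≤ attachment z
      attachment-parent≤ z with onSpine z in on
      ... | true = begin
        attachment (parent z) ≤⟨ attachment≤level (parent z) ⟩
        level (parent z)      ≤⟨ level-parent≤ z ⟩
        level z               ≡⟨ attachment-onSpine z on ⟨
        attachment z          ∎
        where open ≤-Reasoning
      ... | false = ≤-reflexive (≡-sym (attachment-offSpine z on))

      attachment-∼ : ∀ {x w} → x ∼ w → level w + 2 * attachment x ≤ level x + 2 * attachment w + 1
      attachment-∼ {x} {w} x∼w with ∼⇒parent x∼w
      ... | inj₂ (_ , lw) = begin
        level w + 2 * attachment x          ≡⟨ cong (_+ 2 * attachment x) lw ⟨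
        suc (level x) + 2 * attachment x    ≤⟨ +-monoʳ-≤ (suc (level x)) (*-monoʳ-≤ 2 (attachment-x≤)) ⟩
        suc (level x) + 2 * attachment w    ≡⟨ +-comm 1 (level x + 2 * attachment w) ⟩
        level x + 2 * attachment w + 1      ∎
        where
        open ≤-Reasoning
        attachment-x≤ : attachment x ≤ attachment w
        attachment-x≤ = subst (λ p → attachment p ≤ attachment w)
          (≡-sym (IsParentOf⇒≡parent (∼-sym x∼w , lw))) (attachment-parent≤ w)
      ... | inj₁ w-parent@(_ , lx) with onSpine x in on
      ...   | true = ≤-reflexive (begin
        level w + 2 * attachment x          ≡⟨ cong (λ a → level w + 2 * a) (trans (attachment-onSpine x on) (≡-sym lx)) ⟩
        level w + 2 * suc (level w)         ≡⟨ shift (level w) ⟩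
        suc (level w) + 2 * level w + 1     ≡⟨ cong₂ (λ l a → l + 2 * a + 1) lx (≡-sym (attachment-onSpine w onSpine-w)) ⟩
        level x + 2 * attachment w + 1      ∎)
        where
        open ≡-Reasoning
        onSpine-w : onSpine w ≡ true
        onSpine-w = subst (λ p → onSpine p ≡ true) (≡-sym (IsParentOf⇒≡parent w-parent)) (onSpine-parent x on)
        shift : ∀ l → l + 2 * suc l ≡ suc l + 2 * l + 1
        shift = solve-∀
      ...   | false = begin
        level w + 2 * attachment x          ≡⟨ cong (λ a → level w + 2 * a) same-attachment ⟩
        level w + 2 * attachment w          ≤⟨ +-monoˡ-≤ (2 * attachment w) (≤-trans (n≤1+n _) (≤-reflexive lx)) ⟩
        level x + 2 * attachment w          ≤⟨ m≤m+n _ 1 ⟩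
        level x + 2 * attachment w + 1      ∎
        where
        open ≤-Reasoning
        same-attachment : attachment x ≡ attachment w
        same-attachment = trans (attachment-offSpine x on) (cong attachment (≡-sym (IsParentOf⇒≡parent w-parent)))

      attachment-walk : ∀ {x y m} → Walk G x y m →
        level y + 2 * attachment x ≤ level x + 2 * attachment y + m
      attachment-walk here = ≤-reflexive (≡-sym (+-identityʳ _))
      attachment-walk {x} {y} (step {w = w} {m = m} x∼w p) =
        +-cancelʳ-≤ (level w + 2 * attachment w) _ _ (begin
          level y + 2 * attachment x + (level w + 2 * attachment w)
            ≡⟨ swap (level y) (attachment x) (level w) (attachment w) ⟩
          level y + 2 * attachment w + (level w + 2 * attachment x)
            ≤⟨ +-mono-≤ (attachment-walk p) (attachment-∼ x∼w) ⟩
          level w + 2 * attachment y + m + (level x + 2 * attachment w + 1)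
            ≡⟨ regroup (level w) (attachment y) m (level x) (attachment w) ⟩
          level x + 2 * attachment y + suc m + (level w + 2 * attachment w) ∎)
        where
        open ≤-Reasoning
        swap : ∀ a b c e → a + 2 * b + (c + 2 * e) ≡ a + 2 * e + (c + 2 * b)
        swap = solve-∀
        regroup : ∀ a b m c e → a + 2 * b + m + (c + 2 * e + 1) ≡ c + 2 * b + suc m + (a + 2 * e)
        regroup = solve-∀

      -- The walk from v to y has length at most d, while the potential level − 2 · attachment
      -- rises by at most one per step from its value −d at v; so no vertex lies deeper
      -- below the spine than its attachment level.
      level≤2*attachment : ∀ y → level y ≤ 2 * attachment y
      level≤2*attachment y = +-cancelʳ-≤ (2 * d) _ _ (begin
        level y + 2 * d                   ≡⟨ cong (λ a → level y + 2 * a) attachment-v ⟨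
        level y + 2 * attachment v        ≤⟨ attachment-walk (proj₁ (dist-correct v y)) ⟩
        level v + 2 * attachment y + m    ≤⟨ +-monoʳ-≤ (level v + 2 * attachment y) (diameter v y m (dist-correct v y)) ⟩
        level v + 2 * attachment y + d    ≡⟨ cong (λ l → l + 2 * attachment y + d) level-v ⟩
        d + 2 * attachment y + d          ≡⟨ rearrange d (attachment y) ⟩
        2 * attachment y + 2 * d          ∎)
        where
        open ≤-Reasoning
        m = dist v y
        attachment-v : attachment v ≡ d
        attachment-v = trans (attachment-onSpine v onSpine-v) level-v
        rearrange : ∀ d a → d + 2 * a + d ≡ 2 * a + 2 * d
        rearrange = solve-∀

      leaf-below : Fin n → Fin n
      leaf-below = descend d

      leaf-below-spec : ∀ w → Σ ℕ λ j → ancestor j (leaf-below w) ≡ w × level (leaf-below w) ≡ j + level w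
      leaf-below-spec w with descend-spec d w
      ... | j , anc , lev , _ = j , anc , lev

      leaf-below-childless : ∀ w → Childless (leaf-below w)
      leaf-below-childless w with descend-spec d w
      ... | _ , _ , _   , inj₁ childless = childless
      ... | j , _ , lev , inj₂ refl = λ x (_ , lx) → 1+n≰n (begin
        suc d                          ≤⟨ s≤s (m≤m+n d (level w)) ⟩
        suc (d + level w)              ≡⟨ cong suc lev ⟨
        suc (level (leaf-below w))     ≡⟨ lx ⟩
        level x                        ≤⟨ level≤d x ⟩
        d                              ∎)
        where open ≤-Reasoning

      spine-∼ : ∀ {k} → k < d → spine (suc k) ∼ spine k
      spine-∼ {k} k<d = subst (spine (suc k) ∼_) (parent-spine k<d)
        (∼-parent (spine (suc k)) (subst (0 <_) (≡-sym (level-spine k<d)) (s≤s z≤n)))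

      1≤degree : ∀ z → 1 ≤ degree z
      1≤degree z with z Finₚ.≟ root
      ... | yes refl = ∼⇒1≤degree (subst (_∼ spine 1) spine-0 (∼-sym (spine-∼ 0<d)))
      ... | no z≢root = ∼⇒1≤degree (∼-parent z (level>0 z≢root))

      v≢root : v ≢ root
      v≢root v≡root = <⇒≢ 0<d (trans (≡-sym level-root) (trans (cong level (≡-sym v≡root)) level-v))

      degree-v : degree v ≡ 1
      degree-v = childless⇒degree≡1 v v≢root (λ x (_ , lx) →
        1+n≰n (≤-trans (≤-reflexive (trans (cong suc (≡-sym level-v)) lx)) (level≤d x)))

      -- A second neighbour of the root would be off the spine at level 1, hence of attachment 0 and so of level 0.
      degree-root : degree root ≡ 1
      degree-root = ≤-antisym (neighbours≡⇒degree≤1 root (spine 1) only-spine)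
                              (∼⇒1≤degree (subst (_∼ spine 1) spine-0 (∼-sym (spine-∼ 0<d))))
        where
        only-spine : ∀ x → root ∼ x → x ≡ spine 1
        only-spine x root∼x with ∼⇒parent root∼x
        ... | inj₁ (_ , l) = ⊥-elim (1+n≢0 (trans l level-root))
        ... | inj₂ (_ , l) with onSpine x in on
        ...   | true  = trans (≡-sym (onSpine⇒≡ on)) (cong spine level-x)
          where level-x = trans (≡-sym l) (cong suc level-root)
        ...   | false = ⊥-elim (1+n≰n (begin
          1                  ≡⟨ level-x ⟨
          level x            ≤⟨ level≤2*attachment x ⟩
          2 * attachment x   ≡⟨ cong (2 *_) (n<1⇒n≡0 (subst (attachment x <_) level-x (attachment<level x on))) ⟩
          0                  ∎))
          where
          open ≤-Reasoning
          level-x = trans (≡-sym l) (cong suc level-root)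

      interior-spine : ∀ z → onSpine z ≡ true → z ≢ root → z ≢ v → 2 ≤ degree z
      interior-spine z on z≢root z≢v =
        subst (λ w → 2 ≤ degree w) (trans (cong spine (≡-sym lz)) (onSpine⇒≡ on))
          (two-neighbours⇒2≤degree (spine-∼ k<d) (∼-sym (spine-∼ k+1<d))
            (<⇒≢ (m<n⇒m<1+n (n<1+n k)) ∘ spine-injective (≤-trans (n≤1+n k) k<d) k+1<d))
        where
        k = pred (level z)
        lz : level z ≡ suc k
        lz = ≡-sym (suc-pred (level z) {{>-nonZero (level>0 z≢root)}})
        k<d : k < d
        k<d = subst (_≤ d) lz (level≤d z)
        k+1<d : suc k < d
        k+1<d with m≤n⇒m<n∨m≡n k<d
        ... | inj₁ k+1<d = k+1<d
        ... | inj₂ k+1≡d = ⊥-elim (z≢v (trans (≡-sym (onSpine⇒≡ on)) (trans (cong spine (trans lz k+1≡d)) spine-d)))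

      leaf : Fin n → Bool
      leaf z = degree z ≡ᵇ 1

      offSpine : Fin n → Bool
      offSpine = not ∘ onSpine

      count-onSpine : count onSpine ≡ suc d
      count-onSpine = ≤-antisym
        (≤-trans (count-≤-injection onSpine (λ _ → true) (λ z → fromℕ< (s≤s (level≤d z))) (λ _ _ → refl)
                   (λ x y on-x on-y e → trans (≡-sym (onSpine⇒≡ on-x)) (trans (cong spine (level-eq e)) (onSpine⇒≡ on-y))))
                 (≤-reflexive (count-true (suc d))))
        (≤-trans (≤-reflexive (≡-sym (count-true (suc d))))
                 (count-≤-injection (λ _ → true) onSpine (spine ∘ toℕ) (λ k _ → onSpine-spine (toℕ≤d k))
                   (λ i j _ _ e → toℕ-injective (spine-injective (toℕ≤d i) (toℕ≤d j) e))))
        where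
        toℕ≤d : ∀ (k : Fin (suc d)) → toℕ k ≤ d
        toℕ≤d k = s≤s⁻¹ (Finₚ.toℕ<n k)
        level-eq : ∀ {x y} → fromℕ< (s≤s (level≤d x)) ≡ fromℕ< (s≤s (level≤d y)) → level x ≡ level y
        level-eq {x} {y} e = trans (≡-sym (Finₚ.toℕ-fromℕ< _)) (trans (cong toℕ e) (Finₚ.toℕ-fromℕ< _))

      endpoint : Fin n → ℕ
      endpoint z = indicator (z == root) + indicator (z == v)

      sum-endpoint : sum endpoint ≡ 2
      sum-endpoint = trans (∑-distrib-+ {n} _ _) (cong₂ _+_ (count-== root) (count-== v))

      leaves≤offSpine+2 : count leaf ≤ count offSpine + 2
      leaves≤offSpine+2 = begin
        count leaf
          ≤⟨ sum-mono-≤ leaf-site ⟩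
        sum (λ z → indicator (offSpine z) + endpoint z)
          ≡⟨ ∑-distrib-+ {n} _ _ ⟩
        count offSpine + sum endpoint
          ≡⟨ cong (count offSpine +_) sum-endpoint ⟩
        count offSpine + 2 ∎
        where
        open ≤-Reasoning
        leaf-site : ∀ z → indicator (leaf z) ≤ indicator (offSpine z) + endpoint z
        leaf-site z with onSpine z in on | z Finₚ.≟ root | z Finₚ.≟ v
        ... | false | _        | _        = ≤-trans (indicator≤1 (leaf z)) (m≤m+n 1 _)
        ... | true  | yes _    | _        = ≤-trans (indicator≤1 (leaf z)) (m≤m+n 1 _)
        ... | true  | no _     | yes _    = indicator≤1 (leaf z)
        ... | true  | no z≢root | no z≢v  = ≤-reflexive (cong indicator (2≤⇒≢1 (interior-spine z on z≢root z≢v)))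
          where
          2≤⇒≢1 : ∀ {m} → 2 ≤ m → (m ≡ᵇ 1) ≡ false
          2≤⇒≢1 (s≤s (s≤s _)) = refl

      offSpineLeaf : Fin n → Bool
      offSpineLeaf z = leaf z ∧ offSpine z

      offSpineLeaves+2≤leaves : count offSpineLeaf + 2 ≤ count leaf
      offSpineLeaves+2≤leaves = begin
        count offSpineLeaf + 2
          ≡⟨ cong (count offSpineLeaf +_) sum-endpoint ⟨
        count offSpineLeaf + sum endpoint
          ≡⟨ ∑-distrib-+ {n} _ _ ⟨
        sum (λ z → indicator (offSpineLeaf z) + endpoint z)
          ≤⟨ sum-mono-≤ leaf-site ⟩
        count leaf ∎
        where
        open ≤-Reasoning
        spine-leaf : ∀ {z} → degree z ≡ 1 → onSpine z ≡ true → indicator (offSpineLeaf z) + 1 ≤ indicator (leaf z)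
        spine-leaf deg≡1 on rewrite deg≡1 | on = ≤-refl
        leaf-site : ∀ z → indicator (offSpineLeaf z) + endpoint z ≤ indicator (leaf z)
        leaf-site z with z Finₚ.≟ root | z Finₚ.≟ v
        ... | yes refl | yes v≡root  = ⊥-elim (v≢root (≡-sym v≡root))
        ... | yes refl | no _        = spine-leaf degree-root onSpine-root
        ... | no _     | yes refl    = spine-leaf degree-v onSpine-v
        ... | no _     | no _        = ≤-trans (≤-reflexive (+-identityʳ _)) (indicator-∧≤ (leaf z) (offSpine z))

      attachment-ancestor : ∀ j z → onSpine (ancestor j z) ≡ false → attachment z ≡ attachment (ancestor j z)
      attachment-ancestor zero    z _   = refl
      attachment-ancestor (suc j) z off =
        trans (attachment-ancestor j z off′) (attachment-offSpine (ancestor j z) off′)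
        where
        off′ = offSpine-descendant 1 (ancestor j z) off

      leaf-below-offSpineLeaf : ∀ x → offSpine x ≡ true → offSpineLeaf (leaf-below x) ≡ true
      leaf-below-offSpineLeaf x off-x =
        offSpine-leaf (childless⇒degree≡1 (leaf-below x) (offSpine⇒≢root off-ℓ) (leaf-below-childless x)) off-ℓ
        where
        offSpine-leaf : ∀ {z} → degree z ≡ 1 → onSpine z ≡ false → offSpineLeaf z ≡ true
        offSpine-leaf deg≡1 off rewrite deg≡1 | off = refl
        off-ℓ : onSpine (leaf-below x) ≡ false
        off-ℓ = offSpine-descendant (proj₁ (leaf-below-spec x)) (leaf-below x)
                  (subst (λ w → onSpine w ≡ false) (≡-sym (proj₁ (proj₂ (leaf-below-spec x)))) (not-true⁻ off-x))

      -- The fibre over ℓ is a chain of ancestors of ℓ at levels strictly above its attachment level p, and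
      -- level ℓ ≤ 2p, level ℓ ≤ d leave room for at most ⌊d/2⌋ of them.
      fibre≤d/2 : ∀ ℓ → count (λ x → offSpine x ∧ (leaf-below x == ℓ)) ≤ d / 2
      fibre≤d/2 ℓ = count-injective-below _ (λ x → level x ∸ suc (attachment ℓ)) (d / 2) bounded injective
        where
        InFibre : Fin n → Set
        InFibre x = onSpine x ≡ false × Σ ℕ λ j → ancestor j ℓ ≡ x × level ℓ ≡ j + level x
        in-fibre : ∀ x → offSpine x ∧ (leaf-below x == ℓ) ≡ true → InFibre x
        in-fibre x e with ∧-true⁻ {offSpine x} e | leaf-below-spec x
        ... | off-x , ℓ-below | j , anc , lev with refl ← ==⇒≡ {x = leaf-below x} ℓ-below =
          not-true⁻ off-x , j , anc , lev
        attachment-x : ∀ {x} → InFibre x → attachment ℓ ≡ attachment x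
        attachment-x (off , j , refl , _) = attachment-ancestor j ℓ off
        above-attachment : ∀ {x} → InFibre x → attachment ℓ < level x
        above-attachment fib@(off , _) = subst (_< _) (≡-sym (attachment-x fib)) (attachment<level _ off)
        bounded : ∀ x → offSpine x ∧ (leaf-below x == ℓ) ≡ true → level x ∸ suc (attachment ℓ) < d / 2
        bounded x e with in-fibre x e
        ... | fib@(_ , j , _ , lev) = l∸1+p<d/2 (above-attachment fib)
          (subst (level x ≤_) (≡-sym lev) (m≤n+m (level x) j)) (level≤2*attachment ℓ) (level≤d ℓ)
        injective : ∀ x y → offSpine x ∧ (leaf-below x == ℓ) ≡ true → offSpine y ∧ (leaf-below y == ℓ) ≡ true →
          level x ∸ suc (attachment ℓ) ≡ level y ∸ suc (attachment ℓ) → x ≡ y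
        injective x y ex ey e with in-fibre x ex | in-fibre y ey
        ... | fib-x@(_ , jx , refl , lx) | fib-y@(_ , jy , refl , ly) = cong (λ j → ancestor j ℓ) jx≡jy
          where
          same-level = ∸-cancelʳ-≡ (above-attachment fib-x) (above-attachment fib-y) e
          jx≡jy = +-cancelʳ-≡ _ jx jy (trans (≡-sym lx) (trans ly (cong (jy +_) (≡-sym same-level))))

      offSpine≤offSpineLeaves*d/2 : count offSpine ≤ count offSpineLeaf * (d / 2)
      offSpine≤offSpineLeaves*d/2 = count≤count*fibre offSpine offSpineLeaf leaf-below (d / 2) leaf-below-offSpineLeaf fibre≤d/2

module DegreeSequence {n} (δ : Fin n → ℕ) (1≤δ : ∀ w → 1 ≤ δ w) (δ-sum : sum δ + 2 ≡ n + n) where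

  class : ℕ → ℕ
  class j = count (λ w → δ w ≡ᵇ j)

  class>2 : ℕ
  class>2 = count (λ w → 2 <ᵇ δ w)

  excess : ℕ
  excess = sum (λ w → indicator (2 <ᵇ δ w) * (δ w ∸ 2))

  order : n ≡ class 1 + class 2 + class>2
  order = begin
    n                   ≡⟨ sum-ones n ⟨
    sum {n} (λ _ → 1)   ≡⟨ sum-cong-≗ (λ w → classify (δ w) (1≤δ w)) ⟩
    sum (λ w → indicator (δ w ≡ᵇ 1) + indicator (δ w ≡ᵇ 2) + indicator (2 <ᵇ δ w))
                        ≡⟨ ∑-distrib-+ {n} _ _ ⟩
    sum (λ w → indicator (δ w ≡ᵇ 1) + indicator (δ w ≡ᵇ 2)) + class>2
                        ≡⟨ cong (_+ class>2) (∑-distrib-+ {n} _ _) ⟩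
    class 1 + class 2 + class>2 ∎
    where
    open ≡-Reasoning
    classify : ∀ d → 1 ≤ d → 1 ≡ indicator (d ≡ᵇ 1) + indicator (d ≡ᵇ 2) + indicator (2 <ᵇ d)
    classify 1               _ = refl
    classify 2               _ = refl
    classify (suc (suc (suc _))) _ = refl

  class1≡excess+2 : class 1 ≡ excess + 2
  class1≡excess+2 = +-cancelˡ-≡ (sum δ) (class 1) (excess + 2) (begin
    sum δ + class 1                  ≡⟨ ∑-distrib-+ {n} _ _ ⟨
    sum (λ w → δ w + indicator (δ w ≡ᵇ 1))
      ≡⟨ sum-cong-≗ (λ w → leaf-correction (δ w) (1≤δ w)) ⟩
    sum (λ w → 2 + indicator (2 <ᵇ δ w) * (δ w ∸ 2))
      ≡⟨ ∑-distrib-+ {n} _ _ ⟩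
    sum {n} (λ _ → 1 + 1) + excess
      ≡⟨ cong (_+ excess) (trans (∑-distrib-+ {n} _ _) (cong₂ _+_ (sum-ones n) (sum-ones n))) ⟩
    n + n + excess                   ≡⟨ cong (_+ excess) δ-sum ⟨
    sum δ + 2 + excess               ≡⟨ +-assoc (sum δ) 2 excess ⟩
    sum δ + (2 + excess)             ≡⟨ cong (sum δ +_) (+-comm 2 excess) ⟩
    sum δ + (excess + 2)             ∎)
    where
    open ≡-Reasoning
    leaf-correction : ∀ d → 1 ≤ d → d + indicator (d ≡ᵇ 1) ≡ 2 + indicator (2 <ᵇ d) * (d ∸ 2)
    leaf-correction 1                   _ = refl
    leaf-correction 2                   _ = refl
    leaf-correction (suc (suc (suc m))) _ = cong (3 +_) (trans (+-identityʳ m) (≡-sym (+-identityʳ m)))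

  class>2≤excess : class>2 ≤ excess
  class>2≤excess = sum-mono-≤ (λ w → branch (δ w))
    where
    branch : ∀ d → indicator (2 <ᵇ d) ≤ indicator (2 <ᵇ d) * (d ∸ 2)
    branch 0 = z≤n
    branch 1 = z≤n
    branch 2 = z≤n
    branch (suc (suc (suc _))) = s≤s z≤n

  0<excess⇒0<class>2 : 0 < excess → 0 < class>2
  0<excess⇒0<class>2 0<excess with 0<sum⇒∃ _ 0<excess
  ... | w , 0<term = ≤-trans (branch (δ w) 0<term) (≤-sum (indicator ∘ (λ w → 2 <ᵇ δ w)) w)
    where
    branch : ∀ d → 0 < indicator (2 <ᵇ d) * (d ∸ 2) → 0 < indicator (2 <ᵇ d)
    branch (suc (suc (suc _))) _ = s≤s z≤n

  class0≡0 : class 0 ≡ 0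
  class0≡0 = count-false _ (λ w → positive (δ w) (1≤δ w))
    where
    positive : ∀ d → 1 ≤ d → (d ≡ᵇ 0) ≡ false
    positive (suc _) _ = refl

  class≤class>2 : ∀ j → class (3 + j) ≤ class>2
  class≤class>2 j = sum-mono-≤ (λ w → above (δ w))
    where
    above : ∀ d → indicator (d ≡ᵇ 3 + j) ≤ indicator (2 <ᵇ d)
    above 0 = z≤n
    above 1 = z≤n
    above 2 = z≤n
    above (suc (suc (suc d))) = indicator≤1 _

module _ {n} (G : Graph n) where

  ∈D⇒deg≡ : ∀ {j w} → w ∈ D G j → deg G w ≡ j
  ∈D⇒deg≡ {j} {w} w∈D = ≡ᵇ-true⇒≡ (trans (≡-sym (lookup∘tabulate _ w)) ([]=⇒lookup w∈D))

  D-regKIndependent : ∀ {k j} → j ≤ k → RegKIndependent G k (D G j)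
  D-regKIndependent {j = j} j≤k =
      (λ w w∈D → ≤-trans (∣p∩q∣≤∣p∣ (N G w) (D G j)) (≤-trans (≤-reflexive (∈D⇒deg≡ w∈D)) j≤k))
    , (j , λ _ w∈D → w∈D)

  regKIndepNumber≡D₁⊔D₂ : ∀ {k a} → 2 ≤ k → (∀ j → ∣ D G j ∣ ≤ ∣ D G 1 ∣ ⊔ ∣ D G 2 ∣) →
    IsRegKIndepNumber G k a → a ≡ ∣ D G 1 ∣ ⊔ ∣ D G 2 ∣
  regKIndepNumber≡D₁⊔D₂ 2≤k D≤ ((S , (_ , j , S⊆Dj) , ∣S∣≡a) , maximal) = ≤-antisym
    (≤-trans (≤-reflexive (≡-sym ∣S∣≡a)) (≤-trans (p⊆q⇒∣p∣≤∣q∣ (λ {w} → S⊆Dj w)) (D≤ j)))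
    (⊔-lub (maximal (D G 1) (D-regKIndependent (≤-trans (s≤s z≤n) 2≤k)))
           (maximal (D G 2) (D-regKIndependent 2≤k)))

-- The numbers c₁, c₂, c₃ of leaves, of degree-2 vertices and of vertices of degree ≥ 3 in a tree of
-- order n and diameter n − t, with the facts about them that the bounds on α_{k-reg} need.
record DegreeProfile (n t c₁ c₂ c₃ : ℕ) : Set where
  field
    order              : n ≡ c₁ + c₂ + c₃
    1≤c₃               : 1 ≤ c₃
    c₃+2≤c₁            : c₃ + 2 ≤ c₁
    c₁≤t+1             : c₁ ≤ t + 1
    t∸1≤[c₁∸2]*[d/2]   : t ∸ 1 ≤ (c₁ ∸ 2) * ((n ∸ t) / 2)

  3≤c₁ : 3 ≤ c₁
  3≤c₁ = ≤-trans (+-monoˡ-≤ 2 1≤c₃) c₃+2≤c₁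

  c₂+[c₁+c₃]≡n : c₂ + (c₁ + c₃) ≡ n
  c₂+[c₁+c₃]≡n = trans (rearrange c₁ c₂ c₃) (≡-sym order)
    where
    rearrange : ∀ a b c → b + (a + c) ≡ a + b + c
    rearrange = solve-∀

  4≤c₁+c₃ : 4 ≤ c₁ + c₃
  4≤c₁+c₃ = ≤-trans (≤-reflexive (+-comm 3 1)) (+-mono-≤ 3≤c₁ 1≤c₃)

  c₁+c₃≤2t : c₁ + c₃ ≤ 2 * t
  c₁+c₃≤2t = +-cancelʳ-≤ 2 (c₁ + c₃) (2 * t) (begin
    c₁ + c₃ + 2     ≡⟨ +-assoc c₁ c₃ 2 ⟩
    c₁ + (c₃ + 2)   ≤⟨ +-mono-≤ c₁≤t+1 (≤-trans c₃+2≤c₁ c₁≤t+1) ⟩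
    t + 1 + (t + 1) ≡⟨ double t ⟩
    2 * t + 2       ∎)
    where
    open ≤-Reasoning
    double : ∀ t → t + 1 + (t + 1) ≡ 2 * t + 2
    double = solve-∀

  c₂≤n∸4 : c₂ ≤ n ∸ 4
  c₂≤n∸4 = m+n≤o⇒m≤o∸n c₂ (≤-trans (+-monoʳ-≤ c₂ 4≤c₁+c₃) (≤-reflexive c₂+[c₁+c₃]≡n))

  t+2h≤1+c₁h : 1 ≤ t → t + 2 * ((n ∸ t) / 2) ≤ 1 + c₁ * ((n ∸ t) / 2)
  t+2h≤1+c₁h 1≤t = begin
    t + 2 * h                    ≡⟨ cong (_+ 2 * h) (m∸n+n≡m 1≤t) ⟨
    t ∸ 1 + 1 + 2 * h            ≤⟨ +-monoˡ-≤ (2 * h) (+-monoˡ-≤ 1 t∸1≤[c₁∸2]*[d/2]) ⟩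
    (c₁ ∸ 2) * h + 1 + 2 * h     ≡⟨ regroup (c₁ ∸ 2) h ⟩
    1 + (c₁ ∸ 2 + 2) * h         ≡⟨ cong (λ c → 1 + c * h) (m∸n+n≡m (≤-trans (n≤1+n 2) 3≤c₁)) ⟩
    1 + c₁ * h                   ∎
    where
    open ≤-Reasoning
    h = (n ∸ t) / 2
    regroup : ∀ c h → c * h + 1 + 2 * h ≡ 1 + (c + 2) * h
    regroup = solve-∀

  part-i : 2 ≤ t → 3 * t ≤ n ∸ 1 → (n ∸ 2 * t ≤ c₁ ⊔ c₂) × (c₁ ⊔ c₂ ≤ n ∸ 4)
  part-i 2≤t 3t≤n∸1 =
      ≤-trans (m≤n+o⇒m∸n≤o n (2 * t) n≤2t+c₂) (m≤n⊔m c₁ c₂)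
    , ⊔-lub (m+n≤o⇒m≤o∸n c₁ c₁+4≤n) c₂≤n∸4
    where
    open ≤-Reasoning
    n≤2t+c₂ : n ≤ 2 * t + c₂
    n≤2t+c₂ = begin
      n                ≡⟨ c₂+[c₁+c₃]≡n ⟨
      c₂ + (c₁ + c₃)   ≤⟨ +-monoʳ-≤ c₂ c₁+c₃≤2t ⟩
      c₂ + 2 * t       ≡⟨ +-comm c₂ (2 * t) ⟩
      2 * t + c₂       ∎
    t+5≤n : t + 5 ≤ n
    t+5≤n = subst (_≤ n) (+-assoc t 4 1) (m≤n∸1⇒m+1≤n n (≤-trans (s≤s z≤n) (m≤n+m 4 t)) (begin
      t + 4            ≡⟨ +-comm t 4 ⟩
      4 + t            ≤⟨ +-monoˡ-≤ t (*-monoʳ-≤ 2 2≤t) ⟩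
      2 * t + t        ≡⟨ three t ⟩
      3 * t            ≤⟨ 3t≤n∸1 ⟩
      n ∸ 1            ∎))
      where
      three : ∀ t → 2 * t + t ≡ 3 * t
      three = solve-∀
    c₁+4≤n : c₁ + 4 ≤ n
    c₁+4≤n = ≤-trans (+-monoˡ-≤ 4 c₁≤t+1) (≤-trans (≤-reflexive (+-assoc t 1 4)) t+5≤n)

  part-ii : 3 ≤ n ∸ t → (n + 2 ≤ 3 * (c₁ ⊔ c₂)) × (c₁ ⊔ c₂ ≤ (n ∸ f n t ∸ 1) ⊔ (t + 1))
  part-ii 3≤d = n+2≤3M , ⊔-lub (≤-trans c₁≤t+1 (m≤n⊔m _ _)) (≤-trans c₂≤n∸f∸1 (m≤m⊔n _ _))
    where
    open ≤-Reasoning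
    M = c₁ ⊔ c₂
    n+2≤3M : n + 2 ≤ 3 * M
    n+2≤3M = begin
      n + 2              ≡⟨ cong (_+ 2) order ⟩
      c₁ + c₂ + c₃ + 2   ≡⟨ +-assoc (c₁ + c₂) c₃ 2 ⟩
      c₁ + c₂ + (c₃ + 2) ≤⟨ +-monoʳ-≤ (c₁ + c₂) c₃+2≤c₁ ⟩
      c₁ + c₂ + c₁       ≤⟨ +-mono-≤ (+-mono-≤ (m≤m⊔n c₁ c₂) (m≤n⊔m c₁ c₂)) (m≤m⊔n c₁ c₂) ⟩
      M + M + M          ≡⟨ three M ⟩
      3 * M              ∎
      where
      three : ∀ m → m + m + m ≡ 3 * m
      three = solve-∀
    f≤c₁ : f n t ≤ c₁
    f≤c₁ = ≤-trans (fAux≤ (n ∸ t) t (c₁ ∸ 2) 3≤d t∸1≤[c₁∸2]*[d/2])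
                   (≤-reflexive (m∸n+n≡m (≤-trans (n≤1+n 2) 3≤c₁)))
    c₂≤n∸f∸1 : c₂ ≤ n ∸ f n t ∸ 1
    c₂≤n∸f∸1 = m+n≤o⇒m≤o∸n c₂ (m+n≤o⇒m≤o∸n (c₂ + 1) (begin
      c₂ + 1 + f n t     ≤⟨ +-monoʳ-≤ (c₂ + 1) f≤c₁ ⟩
      c₂ + 1 + c₁        ≡⟨ +-assoc c₂ 1 c₁ ⟩
      c₂ + (1 + c₁)      ≤⟨ +-monoʳ-≤ c₂ (≤-trans (≤-reflexive (+-comm 1 c₁)) (+-monoʳ-≤ c₁ 1≤c₃)) ⟩
      c₂ + (c₁ + c₃)     ≡⟨ c₂+[c₁+c₃]≡n ⟩
      n                  ∎))

  part-iii : 1 ≤ t → t + 4 ≡ n → (n ∸ 1 ≤ 2 * (c₁ ⊔ c₂)) × (c₁ ⊔ c₂ ≤ t + 1)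
  part-iii 1≤t t+4≡n = n∸1≤2c₁ , ⊔-lub c₁≤t+1 c₂≤t+1
    where
    open ≤-Reasoning
    d≡4 : n ∸ t ≡ 4
    d≡4 = trans (cong (_∸ t) (trans (≡-sym t+4≡n) (+-comm t 4))) (m+n∸n≡m 4 t)
    n∸1≤2c₁ : n ∸ 1 ≤ 2 * (c₁ ⊔ c₂)
    n∸1≤2c₁ = +-cancelʳ-≤ 1 _ _ (begin
      n ∸ 1 + 1       ≡⟨ m∸n+n≡m (subst (1 ≤_) t+4≡n (≤-trans (s≤s z≤n) (m≤n+m 4 t))) ⟩
      n               ≡⟨ t+4≡n ⟨
      t + 2 * 2       ≤⟨ subst (λ d → t + 2 * (d / 2) ≤ 1 + c₁ * (d / 2)) d≡4 (t+2h≤1+c₁h 1≤t) ⟩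
      1 + c₁ * 2      ≡⟨ +-comm 1 (c₁ * 2) ⟩
      c₁ * 2 + 1      ≤⟨ +-monoˡ-≤ 1 (≤-trans (≤-reflexive (*-comm c₁ 2)) (*-monoʳ-≤ 2 (m≤m⊔n c₁ c₂))) ⟩
      2 * (c₁ ⊔ c₂) + 1 ∎)
    c₂≤t+1 : c₂ ≤ t + 1
    c₂≤t+1 = ≤-trans (+-cancelʳ-≤ 4 c₂ t (begin
      c₂ + 4          ≤⟨ +-monoʳ-≤ c₂ 4≤c₁+c₃ ⟩
      c₂ + (c₁ + c₃)  ≡⟨ c₂+[c₁+c₃]≡n ⟩
      n               ≡⟨ t+4≡n ⟨
      t + 4           ∎)) (m≤m+n t 1)

  part-iv : 1 ≤ t → t + 3 ≡ n → c₁ ⊔ c₂ ≡ t + 1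
  part-iv 1≤t t+3≡n = trans (m≥n⇒m⊔n≡m c₂≤c₁) c₁≡t+1
    where
    open ≤-Reasoning
    d≡3 : n ∸ t ≡ 3
    d≡3 = trans (cong (_∸ t) (trans (≡-sym t+3≡n) (+-comm t 3))) (m+n∸n≡m 3 t)
    c₁≡t+1 : c₁ ≡ t + 1
    c₁≡t+1 = ≤-antisym c₁≤t+1 (+-cancelˡ-≤ 1 _ _ (begin
      1 + (t + 1)     ≡⟨ one+ t ⟩
      t + 2 * 1       ≤⟨ subst (λ d → t + 2 * (d / 2) ≤ 1 + c₁ * (d / 2)) d≡3 (t+2h≤1+c₁h 1≤t) ⟩
      1 + c₁ * 1      ≡⟨ cong (1 +_) (*-identityʳ c₁) ⟩
      1 + c₁          ∎))
      where
      one+ : ∀ t → 1 + (t + 1) ≡ t + 2 * 1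
      one+ = solve-∀
    c₂≤c₁ : c₂ ≤ c₁
    c₂≤c₁ = +-cancelʳ-≤ (c₁ + c₃) c₂ c₁ (begin
      c₂ + (c₁ + c₃)  ≡⟨ c₂+[c₁+c₃]≡n ⟩
      n               ≡⟨ t+3≡n ⟨
      t + 3           ≡⟨ +-assoc t 1 2 ⟨
      t + 1 + 2       ≤⟨ +-mono-≤ (≤-reflexive (≡-sym c₁≡t+1)) (≤-trans (s≤s (s≤s z≤n)) 4≤c₁+c₃) ⟩
      c₁ + (c₁ + c₃)  ∎)

module DiametralTree {n} (T : Graph n) (tree : IsTree T) (t : ℕ) (2≤t : 2 ≤ t) (t+3≤n : t + 3 ≤ n)
                     (diameter : Diameter T (n ∸ t)) where

  open Tree T (proj₁ tree) (proj₂ tree)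

  d : ℕ
  d = n ∸ t

  d+t≡n : d + t ≡ n
  d+t≡n = m∸n+n≡m (≤-trans (m≤m+n t 3) t+3≤n)

  3≤d : 3 ≤ d
  3≤d = m+n≤o⇒m≤o∸n 3 (≤-trans (≤-reflexive (+-comm 3 t)) t+3≤n)

  u v : Fin n
  u = proj₁ (proj₁ diameter)
  v = proj₁ (proj₂ (proj₁ diameter))

  open RootedAt u
  open Spine v d (proj₂ (proj₂ (proj₁ diameter))) (proj₂ diameter) (≤-trans (s≤s z≤n) 3≤d)
  open DegreeSequence degree 1≤degree handshake public

  count-offSpine : count offSpine ≡ t ∸ 1
  count-offSpine = +-cancelˡ-≡ (suc d) _ _ (begin
    suc d + count offSpine          ≡⟨ cong (_+ count offSpine) count-onSpine ⟨
    count onSpine + count offSpine  ≡⟨ count+count-not onSpine ⟩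
    n                               ≡⟨ d+t≡n ⟨
    d + t                           ≡⟨ cong (d +_) (suc[m∸1+n]≡m∸n t 0 (≤-trans (s≤s z≤n) 2≤t)) ⟨
    d + suc (t ∸ 1)                 ≡⟨ +-suc d (t ∸ 1) ⟩
    suc d + (t ∸ 1)                 ∎)
    where open ≡-Reasoning

  leaves≤t+1 : class 1 ≤ t + 1
  leaves≤t+1 = begin
    class 1              ≤⟨ leaves≤offSpine+2 ⟩
    count offSpine + 2   ≡⟨ cong (_+ 2) count-offSpine ⟩
    t ∸ 1 + 2            ≡⟨ +-comm (t ∸ 1) 2 ⟩
    suc (suc (t ∸ 1))    ≡⟨ cong suc (suc[m∸1+n]≡m∸n t 0 (≤-trans (s≤s z≤n) 2≤t)) ⟩
    suc t                ≡⟨ +-comm 1 t ⟩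
    t + 1                ∎
    where open ≤-Reasoning

  t∸1≤[leaves∸2]*h : t ∸ 1 ≤ (class 1 ∸ 2) * (d / 2)
  t∸1≤[leaves∸2]*h = begin
    t ∸ 1                            ≡⟨ count-offSpine ⟨
    count offSpine                   ≤⟨ offSpine≤offSpineLeaves*d/2 ⟩
    count offSpineLeaf * (d / 2)     ≤⟨ *-monoˡ-≤ (d / 2) (m+n≤o⇒m≤o∸n (count offSpineLeaf) offSpineLeaves+2≤leaves) ⟩
    (class 1 ∸ 2) * (d / 2)          ∎
    where open ≤-Reasoning

  3≤leaves : 3 ≤ class 1
  3≤leaves = m∸n≢0⇒n<m leaves∸2≢0
    where
    leaves∸2≢0 : class 1 ∸ 2 ≢ 0
    leaves∸2≢0 e = 1+n≰n (begin
      1                         ≤⟨ m+n≤o⇒m≤o∸n 1 2≤t ⟩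
      t ∸ 1                     ≤⟨ t∸1≤[leaves∸2]*h ⟩
      (class 1 ∸ 2) * (d / 2)   ≡⟨ cong (_* (d / 2)) e ⟩
      0                         ∎)
      where open ≤-Reasoning

  profile : DegreeProfile n t (class 1) (class 2) class>2
  profile = record
    { order            = order
    ; 1≤c₃             = 0<excess⇒0<class>2 (+-cancelʳ-≤ 2 1 excess (≤-trans 3≤leaves (≤-reflexive class1≡excess+2)))
    ; c₃+2≤c₁          = ≤-trans (+-monoˡ-≤ 2 class>2≤excess) (≤-reflexive (≡-sym class1≡excess+2))
    ; c₁≤t+1           = leaves≤t+1
    ; t∸1≤[c₁∸2]*[d/2] = t∸1≤[leaves∸2]*h
    }

  ∣D∣≡class : ∀ j → ∣ D T j ∣ ≡ class j
  ∣D∣≡class j = trans (∣tabulate∣≡count (λ w → deg T w ≡ᵇ j))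
    (sum-cong-≗ (λ w → cong (λ δ → indicator (δ ≡ᵇ j)) (∣tabulate∣≡count (adj T w))))

  ∣D∣≤D₁⊔D₂ : ∀ j → ∣ D T j ∣ ≤ ∣ D T 1 ∣ ⊔ ∣ D T 2 ∣
  ∣D∣≤D₁⊔D₂ j = subst₂ _≤_ (≡-sym (∣D∣≡class j)) (≡-sym (cong₂ _⊔_ (∣D∣≡class 1) (∣D∣≡class 2)))
                          (class≤ j)
    where
    class≤ : ∀ j → class j ≤ class 1 ⊔ class 2
    class≤ 0 = ≤-trans (≤-reflexive class0≡0) z≤n
    class≤ 1 = m≤m⊔n _ _
    class≤ 2 = m≤n⊔m _ _
    class≤ (suc (suc (suc j))) = ≤-trans (class≤class>2 j)
      (≤-trans (m≤m+n _ 2) (≤-trans (DegreeProfile.c₃+2≤c₁ profile) (m≤m⊔n _ _)))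

RegIndepBounds : ℕ → ℕ → ℕ → Set
RegIndepBounds n t a =
  (3 * t ≤ n ∸ 1 → (n ∸ 2 * t ≤ a) × (a ≤ n ∸ 4))
  × (n ≤ 3 * t → t + 5 ≤ n → (n + 2 ≤ 3 * a) × (a ≤ (n ∸ f n t ∸ 1) ⊔ (t + 1)))
  × (t + 4 ≡ n → (n ∸ 1 ≤ 2 * a) × (a ≤ t + 1))
  × (t + 3 ≡ n → a ≡ t + 1)

theorem3p1 : (k n t : ℕ) → 2 ≤ k → 8 ≤ n → 2 ≤ t → t + 3 ≤ n →
    (T : Graph n) → IsTree T → Diameter T (n ∸ t) →
    (a : ℕ) → IsRegKIndepNumber T k a →
      ((3 * t ≤ n ∸ 1 → (n ∸ 2 * t ≤ a) × (a ≤ n ∸ 4))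
      × (n ≤ 3 * t → t + 5 ≤ n → (n + 2 ≤ 3 * a) × (a ≤ (n ∸ f n t ∸ 1) ⊔ (t + 1)))
      × (t + 4 ≡ n → (n ∸ 1 ≤ 2 * a) × (a ≤ t + 1))
      × (t + 3 ≡ n → a ≡ t + 1))
theorem3p1 k n t 2≤k _ 2≤t t+3≤n T tree diameter a α =
  subst (RegIndepBounds n t) (≡-sym a≡leaves⊔class2)
    (part-i 2≤t , (λ _ _ → part-ii 3≤d) , part-iii 1≤t , part-iv 1≤t)
  where
  open DiametralTree T tree t 2≤t t+3≤n diameter
  open DegreeProfile profile
  1≤t = ≤-trans (s≤s z≤n) 2≤t
  a≡leaves⊔class2 : a ≡ class 1 ⊔ class 2
  a≡leaves⊔class2 =
    trans (regKIndepNumber≡D₁⊔D₂ T 2≤k ∣D∣≤D₁⊔D₂ α) (cong₂ _⊔_ (∣D∣≡class 1) (∣D∣≡class 2))
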